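{- For all $n\ge1$, $a(n,2)=n-1$ and $a(n,n-1)=\lfloor n/2\rfloor\cdot\lceil n/2\rceil$.
   Context: An RG-word of length $n$ with maximum letter $k$ is a word $w_1\cdots w_n$ of positive integers with $w_1=1$, $w_i\le\max(w_1,\dots,w_{i-1})+1$ for $i\ge2$, and $\max_iw_i=k$. It is allowable if every even letter in it occurs exactly once. $a(n,k)$ denotes the number of allowable RG-words of length $n$ with maximum letter $k$. -}

module Defs where

open import Data.Nat using (ℕ; zero; suc; _+_; _≡ᵇ_; _≤ᵇ_; _⊔_)
open import Data.Nat.Base using (⌊_/2⌋)
open import Data.Bool using (Bool; true; false; _∧_; not; if_then_else_)
open import Data.List using (List; []; _∷_; length; map; concatMap; filterᵇ; foldr; upTo; applyUpTo)

maxL : List ℕ → ℕ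
maxL = foldr _⊔_ 0

rgFrom : ℕ → List ℕ → Bool
rgFrom m [] = true
rgFrom m (x ∷ xs) = not (x ≡ᵇ 0) ∧ (x ≤ᵇ suc m) ∧ rgFrom (m ⊔ x) xs

isRG : List ℕ → Bool
isRG [] = true
isRG (x ∷ xs) = (x ≡ᵇ 1) ∧ rgFrom 1 xs

occ : ℕ → List ℕ → ℕ
occ a [] = 0
occ a (x ∷ xs) = if x ≡ᵇ a then suc (occ a xs) else occ a xs

isEven : ℕ → Bool
isEven zero = true
isEven (suc zero) = false
isEven (suc (suc n)) = isEven n

allL : {A : Set} → (A → Bool) → List A → Bool
allL p [] = true
allL p (x ∷ xs) = p x ∧ allL p xs

allowable : List ℕ → Bool
allowable w = allL (λ x → if isEven x then occ x w ≡ᵇ 1 else true) w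

words : ℕ → ℕ → List (List ℕ)
words b zero = [] ∷ []
words b (suc n) = concatMap (λ x → map (x ∷_) (words b n)) (applyUpTo suc b)

-- a(n,k): number of allowable RG-words of length n with maximum letter k.
-- Every RG-word of length n has all letters in {1,…,n}, so enumerating
-- words over {1,…,n} loses nothing.
a : ℕ → ℕ → ℕ
a n k = length (filterᵇ (λ w → isRG w ∧ (maxL w ≡ᵇ k) ∧ allowable w) (words n n))

module Submission where

-- An allowable RG-word is read from left to right by a deterministic
-- automaton whose only state is the running maximum m.  After a valid prefix
-- with maximum m every letter 1..m has already occurred, so the next letter is
-- either the new maximum m+1, or an old letter x ≤ m which must be odd (an even
-- old letter would occur twice).
--
-- Counting accepted words of length r+1 by their first letter gives, with
-- N(m,r) the number of accepted completions of length r from state m,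
--     N(m, r+1) = ⌈m/2⌉·N(m,r) + N(m+1, r)        (m smaller than the alphabet),
-- since exactly ⌈m/2⌉ of the letters 1..m are odd.  Both formulas then follow
-- by solving this recurrence: for target 2 the state 2 has a unique completion,
-- and for target n-1 a word of length n climbs 0 → n-1 with a single repeated
-- (odd) letter, giving Σ_{i ≤ n-1} ⌈i/2⌉ = ⌊n/2⌋·⌈n/2⌉.

open import Defs
open import Data.Nat using (ℕ; zero; suc; _+_; _*_; _∸_; _≤_; _<_; z≤n; s≤s; _≡ᵇ_; _≤ᵇ_; _⊔_; ⌊_/2⌋; ⌈_/2⌉)
open import Data.Nat.Properties
open import Data.Nat.ListAction using (sum)
open import Data.Nat.ListAction.Properties using (sum-++)
open import Data.Bool using (Bool; true; false; _∧_; not; if_then_else_; T)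
open import Data.Bool.Properties using (∧-identityʳ; ∧-conicalˡ; ∧-conicalʳ; ¬-not; not-injective; T-≡)
open import Data.List using (List; []; _∷_; _++_; length; map; concatMap; filterᵇ; applyUpTo; [_])
open import Data.List.Properties using (length-++; filter-++; ++-assoc; ++-identityʳ; map-cong; map-++; applyUpTo-∷ʳ)
open import Data.Product using (_×_; _,_)
open import Data.Empty using (⊥-elim)
open import Function using (_∘_)
open import Function.Bundles using (Equivalence)
open import Relation.Nullary using (yes; no; ¬_)
open import Relation.Nullary.Decidable using (T?)
open import Relation.Binary.PropositionalEquality hiding ([_])
open ≡-Reasoning

fromT : ∀ {b} → T b → b ≡ true
fromT = Equivalence.to T-≡

toT : ∀ {b} → b ≡ true → T b
toT = Equivalence.from T-≡

≡ᵇ-refl : ∀ n → (n ≡ᵇ n) ≡ true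
≡ᵇ-refl n = fromT (≡⇒≡ᵇ n n refl)

≡ᵇ-sound : ∀ m n → (m ≡ᵇ n) ≡ true → m ≡ n
≡ᵇ-sound m n = ≡ᵇ⇒≡ m n ∘ toT

≡ᵇ-false : ∀ m n → m ≢ n → (m ≡ᵇ n) ≡ false
≡ᵇ-false m n m≢n = ¬-not (m≢n ∘ ≡ᵇ-sound m n)

≤ᵇ-sound : ∀ m n → (m ≤ᵇ n) ≡ true → m ≤ n
≤ᵇ-sound m n = ≤ᵇ⇒≤ m n ∘ toT

≤ᵇ-complete : ∀ {m n} → m ≤ n → (m ≤ᵇ n) ≡ true
≤ᵇ-complete = fromT ∘ ≤⇒≤ᵇ

≤ᵇ-false : ∀ m n → ¬ m ≤ n → (m ≤ᵇ n) ≡ false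
≤ᵇ-false m n m≰n = ¬-not (m≰n ∘ ≤ᵇ-sound m n)

true≢false : true ≢ false
true≢false ()

occ-++ : ∀ y xs ys → occ y (xs ++ ys) ≡ occ y xs + occ y ys
occ-++ y [] ys = refl
occ-++ y (x ∷ xs) ys with x ≡ᵇ y
... | true  = cong suc (occ-++ y xs ys)
... | false = occ-++ y xs ys

occ-[x]-self : ∀ x → occ x [ x ] ≡ 1
occ-[x]-self x rewrite ≡ᵇ-refl x = refl

occ-[x]-other : ∀ {x y} → x ≢ y → occ y [ x ] ≡ 0
occ-[x]-other {x} {y} x≢y rewrite ≡ᵇ-false x y x≢y = refl

occ-head : ∀ z xs → 1 ≤ occ z (z ∷ xs)
occ-head z xs rewrite ≡ᵇ-refl z = s≤s z≤n

occ-∷-mono : ∀ y z xs → occ y xs ≤ occ y (z ∷ xs)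
occ-∷-mono y z xs with z ≡ᵇ y
... | true  = n≤1+n _
... | false = ≤-refl

maxL-++ : ∀ xs ys → maxL (xs ++ ys) ≡ maxL xs ⊔ maxL ys
maxL-++ [] ys = refl
maxL-++ (x ∷ xs) ys rewrite maxL-++ xs ys = sym (⊔-assoc x (maxL xs) (maxL ys))

occurs⇒≤maxL : ∀ y xs → 1 ≤ occ y xs → y ≤ maxL xs
occurs⇒≤maxL y (x ∷ xs) y∈ with x ≡ᵇ y in x≡ᵇy
... | true rewrite ≡ᵇ-sound x y x≡ᵇy = m≤m⊔n y (maxL xs)
... | false = ≤-trans (occurs⇒≤maxL y xs y∈) (m≤n⊔m x (maxL xs))

rgFrom-++ : ∀ m xs ys → rgFrom m (xs ++ ys) ≡ rgFrom m xs ∧ rgFrom (m ⊔ maxL xs) ys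
rgFrom-++ m [] ys rewrite ⊔-identityʳ m = refl
rgFrom-++ m (x ∷ xs) ys with not (x ≡ᵇ 0) | x ≤ᵇ suc m
... | false | _     = refl
... | true  | false = refl
... | true  | true rewrite rgFrom-++ (m ⊔ x) xs ys | ⊔-assoc m x (maxL xs) = refl

isRG≡rgFrom0 : ∀ w → isRG w ≡ rgFrom 0 w
isRG≡rgFrom0 [] = refl
isRG≡rgFrom0 (zero ∷ xs) = refl
isRG≡rgFrom0 (suc zero ∷ xs) = refl
isRG≡rgFrom0 (suc (suc k) ∷ xs) = refl

allL⇒occurring : ∀ (p : ℕ → Bool) v → allL p v ≡ true → ∀ y → 1 ≤ occ y v → p y ≡ true
allL⇒occurring p (z ∷ zs) all-p y y∈ with z ≡ᵇ y in z≡ᵇy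
... | true rewrite sym (≡ᵇ-sound z y z≡ᵇy) = ∧-conicalˡ (p z) (allL p zs) all-p
... | false = allL⇒occurring p zs (∧-conicalʳ (p z) (allL p zs) all-p) y y∈

occurring⇒allL : ∀ (p : ℕ → Bool) v → (∀ y → 1 ≤ occ y v → p y ≡ true) → allL p v ≡ true
occurring⇒allL p [] _ = refl
occurring⇒allL p (z ∷ zs) occ-p rewrite occ-p z (occ-head z zs) =
  occurring⇒allL p zs (λ y y∈ → occ-p y (≤-trans y∈ (occ-∷-mono y z zs)))

evenOnce : List ℕ → ℕ → Bool
evenOnce v x = if isEven x then occ x v ≡ᵇ 1 else true

allowable⇒even-once : ∀ v → allowable v ≡ true →
  ∀ y → 1 ≤ occ y v → isEven y ≡ true → occ y v ≡ 1
allowable⇒even-once v allowed y y∈ even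
  with allL⇒occurring (evenOnce v) v allowed y y∈
... | once rewrite even = ≡ᵇ-sound _ 1 once

even-once⇒allowable : ∀ v → (∀ y → 1 ≤ occ y v → isEven y ≡ true → occ y v ≡ 1) →
  allowable v ≡ true
even-once⇒allowable v once = occurring⇒allL (evenOnce v) v test
  where
  test : ∀ y → 1 ≤ occ y v → evenOnce v y ≡ true
  test y y∈ with isEven y in even
  ... | true rewrite once y y∈ even = refl
  ... | false = refl

allowable-snoc : ∀ pre x → allowable pre ≡ true →
  (isEven x ≡ true → occ x pre ≡ 0) → allowable (pre ++ [ x ]) ≡ true
allowable-snoc pre x allowed fresh = even-once⇒allowable (pre ++ [ x ]) once
  where
  once : ∀ y → 1 ≤ occ y (pre ++ [ x ]) → isEven y ≡ true → occ y (pre ++ [ x ]) ≡ 1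
  once y y∈ even rewrite occ-++ y pre [ x ] with y ≟ x
  ... | yes refl rewrite fresh even | occ-[x]-self y = refl
  ... | no y≢x rewrite occ-[x]-other (y≢x ∘ sym) | +-identityʳ (occ y pre) =
        allowable⇒even-once pre allowed y y∈ even

-- Valid prefixes and the automaton

-- A valid prefix with running maximum m.  The field 'covers' (every letter
-- 1..m occurs) holds for every RG-word; it is what forbids reusing an even
-- letter later on.
record Prefix (m : ℕ) (pre : List ℕ) : Set where
  field
    rg      : rgFrom 0 pre ≡ true
    maximum : maxL pre ≡ m
    allowed : allowable pre ≡ true
    covers  : ∀ y → 1 ≤ y → y ≤ m → 1 ≤ occ y pre
open Prefix

prefix-[] : Prefix 0 []
prefix-[] = record { rg = refl ; maximum = refl ; allowed = refl ; covers = λ { y (s≤s _) () } }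

prefix-new-max : ∀ {m pre} → Prefix m pre → Prefix (suc m) (pre ++ [ suc m ])
prefix-new-max {m} {pre} p = record { rg = rg′ ; maximum = maximum′ ; allowed = allowed′ ; covers = covers′ }
  where
  rg′ : rgFrom 0 (pre ++ [ suc m ]) ≡ true
  rg′ rewrite rgFrom-++ 0 pre [ suc m ] | rg p | maximum p | ≤ᵇ-complete (≤-refl {suc m}) = refl
  maximum′ : maxL (pre ++ [ suc m ]) ≡ suc m
  maximum′ rewrite maxL-++ pre [ suc m ] | maximum p = m≤n⇒m⊔n≡n (n≤1+n m)
  fresh : occ (suc m) pre ≡ 0
  fresh with occ (suc m) pre in occurrences
  ... | zero  = refl
  ... | suc _ = ⊥-elim (1+n≰n (subst (suc m ≤_) (maximum p)
                  (occurs⇒≤maxL (suc m) pre (subst (1 ≤_) (sym occurrences) (s≤s z≤n)))))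
  allowed′ : allowable (pre ++ [ suc m ]) ≡ true
  allowed′ = allowable-snoc pre (suc m) (allowed p) (λ _ → fresh)
  covers′ : ∀ y → 1 ≤ y → y ≤ suc m → 1 ≤ occ y (pre ++ [ suc m ])
  covers′ y 1≤y y≤1+m rewrite occ-++ y pre [ suc m ] with y ≟ suc m
  ... | yes refl rewrite occ-[x]-self y = m≤n+m 1 (occ y pre)
  ... | no y≢1+m = ≤-trans (covers p y 1≤y (≤-pred (≤∧≢⇒< y≤1+m y≢1+m))) (m≤m+n (occ y pre) _)

prefix-old-odd : ∀ {m pre x} → Prefix m pre → x ≤ m → isEven x ≡ false → Prefix m (pre ++ [ x ])
prefix-old-odd {x = zero} p _ ()
prefix-old-odd {m} {pre} {suc k} p x≤m odd = record { rg = rg′ ; maximum = maximum′ ; allowed = allowed′ ; covers = covers′ }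
  where
  rg′ : rgFrom 0 (pre ++ [ suc k ]) ≡ true
  rg′ rewrite rgFrom-++ 0 pre [ suc k ] | rg p | maximum p | ≤ᵇ-complete (m≤n⇒m≤1+n x≤m) = refl
  maximum′ : maxL (pre ++ [ suc k ]) ≡ m
  maximum′ rewrite maxL-++ pre [ suc k ] | maximum p = m≥n⇒m⊔n≡m x≤m
  allowed′ : allowable (pre ++ [ suc k ]) ≡ true
  allowed′ = allowable-snoc pre (suc k) (allowed p) (λ even → ⊥-elim (true≢false (trans (sym even) odd)))
  covers′ : ∀ y → 1 ≤ y → y ≤ m → 1 ≤ occ y (pre ++ [ suc k ])
  covers′ y 1≤y y≤m rewrite occ-++ y pre [ suc k ] = ≤-trans (covers p y 1≤y y≤m) (m≤m+n (occ y pre) _)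

valid : ℕ → List ℕ → Bool
valid K v = rgFrom 0 v ∧ (maxL v ≡ᵇ K) ∧ allowable v

accepts : ℕ → ℕ → List ℕ → Bool
accepts K m [] = m ≡ᵇ K
accepts K m (x ∷ w) =
  if x ≡ᵇ suc m then accepts K (suc m) w else ((x ≤ᵇ m) ∧ not (isEven x)) ∧ accepts K m w

next-letter-range : ∀ {m pre} x w → Prefix m pre → rgFrom 0 (pre ++ x ∷ w) ≡ true →
  1 ≤ x × x ≤ suc m
next-letter-range {m} {pre} x w p rg-word = positive x rg-next , bounded
  where
  rg-next : rgFrom (maxL pre) (x ∷ w) ≡ true
  rg-next = ∧-conicalʳ (rgFrom 0 pre) _ (trans (sym (rgFrom-++ 0 pre (x ∷ w))) rg-word)
  positive : ∀ y {b} → not (y ≡ᵇ 0) ∧ b ≡ true → 1 ≤ y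
  positive (suc _) _ = s≤s z≤n
  bounded : x ≤ suc m
  bounded = subst (λ k → x ≤ suc k) (maximum p)
              (≤ᵇ-sound x _ (∧-conicalˡ (x ≤ᵇ suc (maxL pre)) _ (∧-conicalʳ (not (x ≡ᵇ 0)) _ rg-next)))

-- After a valid prefix with maximum m, an even letter x ≤ m cannot follow:
-- it occurs already, so it would occur twice.
even-old-letter-repeats : ∀ {m pre} x w → Prefix m pre → 1 ≤ x → x ≤ m → isEven x ≡ true →
  ¬ allowable (pre ++ x ∷ w) ≡ true
even-old-letter-repeats {m} {pre} x w p 1≤x x≤m even allowed-word = 1+n≰n (subst (2 ≤_) once twice)
  where
  twice : 2 ≤ occ x (pre ++ x ∷ w)
  twice rewrite occ-++ x pre (x ∷ w) = +-mono-≤ (covers p x 1≤x x≤m) (occ-head x w)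
  once : occ x (pre ++ x ∷ w) ≡ 1
  once = allowable⇒even-once (pre ++ x ∷ w) allowed-word x (≤-trans (s≤s z≤n) twice) even

rejected-letter : ∀ K {m pre} x w → Prefix m pre → (x ≡ᵇ suc m) ≡ false →
  ((x ≤ᵇ m) ∧ not (isEven x)) ≡ false → ¬ valid K (pre ++ x ∷ w) ≡ true
rejected-letter K {m} {pre} x w p not-new not-old-odd valid-word
  with next-letter-range x w p (∧-conicalˡ (rgFrom 0 (pre ++ x ∷ w)) _ valid-word)
... | 1≤x , x≤1+m = even-old-letter-repeats x w p 1≤x x≤m even allowed-word
  where
  x≢1+m : x ≢ suc m
  x≢1+m refl = true≢false (trans (sym (≡ᵇ-refl (suc m))) not-new)
  x≤m : x ≤ m
  x≤m = ≤-pred (≤∧≢⇒< x≤1+m x≢1+m)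
  even : isEven x ≡ true
  even = not-injective (subst (λ b → b ∧ not (isEven x) ≡ false) (≤ᵇ-complete x≤m) not-old-odd)
  allowed-word : allowable (pre ++ x ∷ w) ≡ true
  allowed-word = ∧-conicalʳ (maxL (pre ++ x ∷ w) ≡ᵇ K) _ (∧-conicalʳ (rgFrom 0 (pre ++ x ∷ w)) _ valid-word)

accepts-correct : ∀ K {m} pre w → Prefix m pre → valid K (pre ++ w) ≡ accepts K m w
accepts-correct K pre [] p rewrite ++-identityʳ pre | rg p | maximum p | allowed p = ∧-identityʳ _
accepts-correct K {m} pre (x ∷ w) p = by-first-letter
  where
  continue : ∀ {m′} → Prefix m′ (pre ++ [ x ]) → valid K (pre ++ x ∷ w) ≡ accepts K m′ w
  continue p′ = subst (λ v → valid K v ≡ _) (++-assoc pre [ x ] w) (accepts-correct K (pre ++ [ x ]) w p′)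
  by-first-letter : valid K (pre ++ x ∷ w) ≡ accepts K m (x ∷ w)
  by-first-letter with x ≡ᵇ suc m in new
  ... | true with refl ← ≡ᵇ-sound x (suc m) new = continue (prefix-new-max p)
  ... | false with (x ≤ᵇ m) ∧ not (isEven x) in old-odd
  ...   | true  = continue (prefix-old-odd p (≤ᵇ-sound x m (∧-conicalˡ _ _ old-odd))
                                             (not-injective (∧-conicalʳ (x ≤ᵇ m) _ old-odd)))
  ...   | false = ¬-not (rejected-letter K x w p new old-odd)

count : {A : Set} → (A → Bool) → List A → ℕ
count P xs = length (filterᵇ P xs)

count-cong : ∀ {A : Set} {P Q : A → Bool} xs → (∀ x → P x ≡ Q x) → count P xs ≡ count Q xs
count-cong [] _ = refl
count-cong {P = P} {Q} (y ∷ ys) P≗Q rewrite P≗Q y with Q y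
... | true  = cong suc (count-cong ys P≗Q)
... | false = count-cong ys P≗Q

count-none : ∀ {A : Set} {P : A → Bool} xs → (∀ x → P x ≡ false) → count P xs ≡ 0
count-none [] _ = refl
count-none {P = P} (y ∷ ys) none rewrite none y = count-none ys none

count-++ : ∀ {A : Set} (P : A → Bool) xs ys → count P (xs ++ ys) ≡ count P xs + count P ys
count-++ P xs ys = trans (cong length (filter-++ (T? ∘ P) xs ys)) (length-++ (filterᵇ P xs))

count-map : ∀ {A B : Set} (P : B → Bool) (f : A → B) xs → count P (map f xs) ≡ count (P ∘ f) xs
count-map P f [] = refl
count-map P f (y ∷ ys) with P (f y)
... | true  = cong suc (count-map P f ys)
... | false = count-map P f ys

count-concatMap : ∀ {A B : Set} (P : B → Bool) (f : A → List B) xs →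
  count P (concatMap f xs) ≡ sum (map (count P ∘ f) xs)
count-concatMap P f [] = refl
count-concatMap P f (y ∷ ys) =
  trans (count-++ P (f y) (concatMap f ys)) (cong (count P (f y) +_) (count-concatMap P f ys))

count-if : ∀ {A : Set} c (P Q : A → Bool) xs →
  count (λ w → if c then P w else Q w) xs ≡ (if c then count P xs else count Q xs)
count-if true  P Q xs = refl
count-if false P Q xs = refl

count-∧ : ∀ {A : Set} c (P : A → Bool) xs → count (λ w → c ∧ P w) xs ≡ (if c then count P xs else 0)
count-∧ true  P xs = refl
count-∧ false P xs = count-none xs (λ _ → refl)

count-words-suc : ∀ (P : List ℕ → Bool) b r →
  count P (words b (suc r)) ≡ sum (map (λ x → count (P ∘ (x ∷_)) (words b r)) (applyUpTo suc b))
count-words-suc P b r =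
  trans (count-concatMap P (λ x → map (x ∷_) (words b r)) (applyUpTo suc b))
        (cong sum (map-cong (λ x → count-map P (x ∷_) (words b r)) (applyUpTo suc b)))

sum-applyUpTo-suc : ∀ (g : ℕ → ℕ) f n →
  sum (map g (applyUpTo f (suc n))) ≡ sum (map g (applyUpTo f n)) + g (f n)
sum-applyUpTo-suc g f n = begin
  sum (map g (applyUpTo f (suc n)))             ≡⟨ cong (sum ∘ map g) (sym (applyUpTo-∷ʳ f n)) ⟩
  sum (map g (applyUpTo f n ++ [ f n ]))         ≡⟨ cong sum (map-++ g (applyUpTo f n) [ f n ]) ⟩
  sum (map g (applyUpTo f n) ++ [ g (f n) ])     ≡⟨ sum-++ (map g (applyUpTo f n)) [ g (f n) ] ⟩
  sum (map g (applyUpTo f n)) + (g (f n) + 0)    ≡⟨ cong (sum (map g (applyUpTo f n)) +_) (+-identityʳ (g (f n))) ⟩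
  sum (map g (applyUpTo f n)) + g (f n)          ∎

-- The recurrence for the number of accepted completions

completions : (K b m r : ℕ) → ℕ
completions K b m r = count (accepts K m) (words b r)

a≡completions : ∀ n k → a n k ≡ completions k n 0 n
a≡completions n k = count-cong (words n n) same-test
  where
  same-test : ∀ w → (isRG w ∧ (maxL w ≡ᵇ k) ∧ allowable w) ≡ accepts k 0 w
  same-test w = trans (cong (λ t → t ∧ ((maxL w ≡ᵇ k) ∧ allowable w)) (isRG≡rgFrom0 w))
                      (accepts-correct k [] w prefix-[])

firstLetter : (K b m r x : ℕ) → ℕ
firstLetter K b m r x =
  if x ≡ᵇ suc m then completions K b (suc m) r
  else if (x ≤ᵇ m) ∧ not (isEven x) then completions K b m r else 0

completions-suc : ∀ K b m r →
  completions K b m (suc r) ≡ sum (map (firstLetter K b m r) (applyUpTo suc b))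
completions-suc K b m r =
  trans (count-words-suc (accepts K m) b r) (cong sum (map-cong by-letter (applyUpTo suc b)))
  where
  by-letter : ∀ x → count (accepts K m ∘ (x ∷_)) (words b r) ≡ firstLetter K b m r x
  by-letter x = trans (count-if (x ≡ᵇ suc m) (accepts K (suc m)) (λ w → oldOdd ∧ accepts K m w) (words b r))
                      (cong (λ c → if x ≡ᵇ suc m then completions K b (suc m) r else c)
                            (count-∧ oldOdd (accepts K m) (words b r)))
    where
    oldOdd : Bool
    oldOdd = (x ≤ᵇ m) ∧ not (isEven x)

-- ⌈n/2⌉ is the number of odd letters among 1..n.
⌈/2⌉-suc : ∀ n v → ⌈ suc n /2⌉ * v ≡ ⌈ n /2⌉ * v + (if not (isEven (suc n)) then v else 0)
⌈/2⌉-suc zero v = +-identityʳ v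
⌈/2⌉-suc (suc zero) v = sym (+-identityʳ _)
⌈/2⌉-suc (suc (suc n)) v rewrite ⌈/2⌉-suc n v = sym (+-assoc v _ _)

module FirstLetterSums (K b m r : ℕ) where
  partial : ℕ → ℕ
  partial n = sum (map (firstLetter K b m r) (applyUpTo suc n))

  -- Among the old letters 1..n (n ≤ m) the odd ones each contribute N(m,r).
  old-letters : ∀ n → n ≤ m → partial n ≡ ⌈ n /2⌉ * completions K b m r
  old-letters zero _ = refl
  old-letters (suc n) n<m
    rewrite sum-applyUpTo-suc (firstLetter K b m r) suc n | old-letters n (≤-trans (n≤1+n n) n<m)
          | ≡ᵇ-false n m (<⇒≢ n<m) | ≤ᵇ-complete n<m | ⌈/2⌉-suc n (completions K b m r) = refl

  -- The new maximum m+1 contributes N(m+1,r); larger letters contribute nothing.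
  beyond-new-letter : ∀ t → partial (t + suc m) ≡ ⌈ m /2⌉ * completions K b m r + completions K b (suc m) r
  beyond-new-letter zero
    rewrite sum-applyUpTo-suc (firstLetter K b m r) suc m | old-letters m ≤-refl | ≡ᵇ-refl m = refl
  beyond-new-letter (suc t)
    rewrite sum-applyUpTo-suc (firstLetter K b m r) suc (t + suc m) | beyond-new-letter t
          | ≡ᵇ-false (t + suc m) m (>⇒≢ (m≤n+m (suc m) t))
          | ≤ᵇ-false (suc (t + suc m)) m (<⇒≱ (m≤n⇒m≤1+n (m≤n+m (suc m) t))) = +-identityʳ _

completions-rec : ∀ K b m r → m < b →
  completions K b m (suc r) ≡ ⌈ m /2⌉ * completions K b m r + completions K b (suc m) r
completions-rec K b m r m<b = begin
  completions K b m (suc r)    ≡⟨ completions-suc K b m r ⟩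
  partial b                    ≡⟨ cong partial (sym (m∸n+n≡m m<b)) ⟩
  partial (b ∸ suc m + suc m)  ≡⟨ beyond-new-letter (b ∸ suc m) ⟩
  ⌈ m /2⌉ * completions K b m r + completions K b (suc m) r ∎
  where open FirstLetterSums K b m r

completions-full : ∀ K b r → completions K b b (suc r) ≡ ⌈ b /2⌉ * completions K b b r
completions-full K b r = trans (completions-suc K b b r) (old-letters b ≤-refl)
  where open FirstLetterSums K b b r

completions-at-target : ∀ K b → completions K b K 0 ≡ 1
completions-at-target K b rewrite ≡ᵇ-refl K = refl

completions-off-target : ∀ K b m → m ≢ K → completions K b m 0 ≡ 0
completions-off-target K b m m≢K rewrite ≡ᵇ-false m K m≢K = refl

-- The maximum never decreases, so a state beyond the target accepts nothing.
completions-beyond-target : ∀ K b m r → K < m → completions K b m r ≡ 0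
completions-beyond-target K b m r K<m = count-none (words b r) (rejects K<m)
  where
  rejects : ∀ {m} → K < m → ∀ w → accepts K m w ≡ false
  rejects {m} K<m [] = ≡ᵇ-false m K (>⇒≢ K<m)
  rejects {m} K<m (x ∷ w) with x ≡ᵇ suc m | (x ≤ᵇ m) ∧ not (isEven x)
  ... | true  | _     = rejects (m≤n⇒m≤1+n K<m) w
  ... | false | true  = rejects K<m w
  ... | false | false = refl

-- Target 2: a(n,2) = n - 1

-- From state 2 only the letter 1 may follow, so each length has one completion.
target2-from2 : ∀ k r → completions 2 (2 + k) 2 r ≡ 1
target2-from2 k zero = completions-at-target 2 (2 + k)
target2-from2 zero (suc r) rewrite completions-full 2 2 r | target2-from2 zero r = refl
target2-from2 (suc k) (suc r)
  rewrite completions-rec 2 (3 + k) 2 r (s≤s (s≤s (s≤s z≤n))) | target2-from2 (suc k) r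
        | completions-beyond-target 2 (3 + k) 3 r ≤-refl = refl

-- From state 1 the letter 2 is placed at one of the r positions.
target2-from1 : ∀ k r → completions 2 (2 + k) 1 r ≡ r
target2-from1 k zero = completions-off-target 2 (2 + k) 1 (λ ())
target2-from1 k (suc r) = begin
  completions 2 (2 + k) 1 (suc r)                     ≡⟨ completions-rec 2 (2 + k) 1 r (s≤s (s≤s z≤n)) ⟩
  1 * completions 2 (2 + k) 1 r + completions 2 (2 + k) 2 r ≡⟨ cong₂ _+_ (trans (*-identityˡ _) (target2-from1 k r)) (target2-from2 k r) ⟩
  r + 1                                               ≡⟨ +-comm r 1 ⟩
  suc r                                               ∎

-- A word of length n first reads 1 (state 0 → 1) and then places the letter 2.
a-target2 : ∀ n → 1 ≤ n → a n 2 ≡ n ∸ 1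
a-target2 1 _ = refl
a-target2 (suc (suc k)) _ = begin
  a (2 + k) 2                          ≡⟨ a≡completions (2 + k) 2 ⟩
  completions 2 (2 + k) 0 (2 + k)      ≡⟨ completions-rec 2 (2 + k) 0 (suc k) (s≤s z≤n) ⟩
  completions 2 (2 + k) 1 (suc k)      ≡⟨ target2-from1 k (suc k) ⟩
  suc k                                ∎

-- Target n - 1: a(n,n-1) = ⌊n/2⌋·⌈n/2⌉

ceilHalfSum : ℕ → ℕ → ℕ
ceilHalfSum m zero = ⌈ m /2⌉
ceilHalfSum m (suc d) = ⌈ m /2⌉ + ceilHalfSum (suc m) d

ceilHalfSum-snoc : ∀ d m → ceilHalfSum m (suc d) ≡ ceilHalfSum m d + ⌈ m + suc d /2⌉
ceilHalfSum-snoc zero m = cong (λ k → ⌈ m /2⌉ + ⌈ k /2⌉) (sym (+-comm m 1))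
ceilHalfSum-snoc (suc d) m rewrite ceilHalfSum-snoc d (suc m) | +-suc m (suc d) =
  sym (+-assoc ⌈ m /2⌉ _ _)

ceilHalfSum-closed : ∀ K → ceilHalfSum 0 K ≡ ⌊ suc K /2⌋ * ⌈ suc K /2⌉
ceilHalfSum-closed zero = refl
ceilHalfSum-closed (suc K) = begin
  ceilHalfSum 0 (suc K)                    ≡⟨ ceilHalfSum-snoc K 0 ⟩
  ceilHalfSum 0 K + ⌈ suc K /2⌉            ≡⟨ cong (_+ ⌈ suc K /2⌉) (ceilHalfSum-closed K) ⟩
  ⌊ suc K /2⌋ * ⌈ suc K /2⌉ + ⌈ suc K /2⌉  ≡⟨ +-comm _ ⌈ suc K /2⌉ ⟩
  suc ⌊ suc K /2⌋ * ⌈ suc K /2⌉            ≡⟨ *-comm (suc ⌊ suc K /2⌋) _ ⟩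
  ⌈ suc K /2⌉ * suc ⌊ suc K /2⌋            ∎

-- With an alphabet larger than the target K, the state m must climb to K.
module ClimbToTarget (K b : ℕ) (K<b : K < b) where
  m≤K⇒m<b : ∀ {m} → m ≤ K → m < b
  m≤K⇒m<b m≤K = ≤-<-trans m≤K K<b

  too-short : ∀ m r → m + r < K → completions K b m r ≡ 0
  too-short m zero m<K = completions-off-target K b m (<⇒≢ (subst (_< K) (+-identityʳ m) m<K))
  too-short m (suc r) m+r<K
    rewrite completions-rec K b m r (m≤K⇒m<b (≤-trans (m≤m+n m (suc r)) (<⇒≤ m+r<K)))
          | too-short m r (≤-<-trans (+-monoʳ-≤ m (n≤1+n r)) m+r<K)
          | too-short (suc m) r (subst (_< K) (+-suc m r) m+r<K) = trans (+-identityʳ _) (*-zeroʳ ⌈ m /2⌉)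

  -- Exactly K - m letters: the only completion is m+1, m+2, …, K.
  exact-length : ∀ m d → m + d ≡ K → completions K b m d ≡ 1
  exact-length m zero m+0≡K rewrite sym m+0≡K | +-identityʳ m = completions-at-target m b
  exact-length m (suc d) m+d≡K
    rewrite completions-rec K b m d (m≤K⇒m<b (subst (m ≤_) m+d≡K (m≤m+n m (suc d))))
          | too-short m d (subst (m + d <_) (trans (sym (+-suc m d)) m+d≡K) (n<1+n (m + d)))
          | exact-length (suc m) d (trans (sym (+-suc m d)) m+d≡K) = cong (_+ 1) (*-zeroʳ ⌈ m /2⌉)

  -- One letter to spare: the climb is interrupted once by an odd letter ≤ the
  -- current maximum i, in ⌈i/2⌉ ways, for some i between m and K.
  one-spare : ∀ m d → m + d ≡ K → completions K b m (suc d) ≡ ceilHalfSum m d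
  one-spare m zero m+0≡K with refl ← trans (sym (+-identityʳ m)) m+0≡K
    rewrite completions-rec K b K 0 K<b | completions-at-target K b
          | completions-off-target K b (suc K) (>⇒≢ (n<1+n K)) = trans (+-identityʳ _) (*-identityʳ _)
  one-spare m (suc d) m+d≡K
    rewrite completions-rec K b m (suc d) (m≤K⇒m<b (subst (m ≤_) m+d≡K (m≤m+n m (suc d))))
          | exact-length m (suc d) m+d≡K
          | one-spare (suc m) d (trans (sym (+-suc m d)) m+d≡K) = cong (_+ ceilHalfSum (suc m) d) (*-identityʳ ⌈ m /2⌉)

-- A word of length n reaching maximum n-1 has exactly one letter to spare.
a-target-n∸1 : ∀ n → 1 ≤ n → a n (n ∸ 1) ≡ ⌊ n /2⌋ * ⌈ n /2⌉
a-target-n∸1 (suc K) _ = begin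
  a (suc K) K                          ≡⟨ a≡completions (suc K) K ⟩
  completions K (suc K) 0 (suc K)      ≡⟨ ClimbToTarget.one-spare K (suc K) (n<1+n K) 0 K refl ⟩
  ceilHalfSum 0 K                      ≡⟨ ceilHalfSum-closed K ⟩
  ⌊ suc K /2⌋ * ⌈ suc K /2⌉            ∎

proposition3p4 : ∀ (n : ℕ) → 1 ≤ n →
    (a n 2 ≡ n ∸ 1) × (a n (n ∸ 1) ≡ ⌊ n /2⌋ * ⌈ n /2⌉)
proposition3p4 n 1≤n = a-target2 n 1≤n , a-target-n∸1 n 1≤n
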